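{- Let $G$ be a graph of order $n$ and $\overline{G}$ its complement. Then $$\eta_k(G)+\eta_k(\overline{G})\geq \binom{n}{k}\quad\text{for all } k>1,$$ and in particular $$\eta(G)+\eta(\overline{G})\geq 2^n+n-1.$$ Equality holds in the latter inequality if and only if $G$ or $\overline{G}$ has no induced path of length at least $3$.
   Context: All graphs are finite, simple and undirected. $\overline{G}$ has the same vertex set as $G$, and $uv\in E(\overline{G})$ iff $uv\notin E(G)$ (for $u\neq v$). $\eta(G)$ denotes the number of nonempty vertex subsets $S\subseteq V(G)$ such that the induced subgraph $\langle S\rangle_G$ is connected (the number of nonempty connected induced subgraphs), and $\eta_k(G)$ the number of such subsets with $|S|=k$. The length of a path is its number of edges. -}

module Defs where

open import Data.Nat using (ℕ; zero; suc; _+_; _∸_; _^_; _≤_; _<_)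
open import Data.Bool using (Bool; true; false; not; if_then_else_)
open import Data.Empty using (⊥-elim)
open import Data.Fin using (Fin; toℕ; _≟_)
open import Data.Fin.Subset using (Subset; _∈_; ∣_∣; Nonempty)
open import Data.List using (List; length)
open import Data.List.Relation.Unary.Unique.Propositional using (Unique)
import Data.List.Membership.Propositional as L
open import Data.Product using (Σ; _×_; ∃)
open import Data.Sum using (_⊎_)
open import Function using (_⇔_)
open import Function.Definitions using (Injective)
open import Relation.Binary.PropositionalEquality using (_≡_; refl; sym)
open import Relation.Nullary using (yes; no)
open import Relation.Nullary.Decidable using (⌊_⌋)

record Graph (n : ℕ) : Set where
  field
    adj    : Fin n → Fin n → Bool
    adj-sym    : ∀ u v → adj u v ≡ adj v u
    adj-irrefl : ∀ u → adj u u ≡ false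
open Graph public

complement : ∀ {n} → Graph n → Graph n
complement {n} G = record { adj = a ; adj-sym = s ; adj-irrefl = i }
  where
  a : Fin n → Fin n → Bool
  a u v = if ⌊ u ≟ v ⌋ then false else not (adj G u v)
  s : ∀ u v → a u v ≡ a v u
  s u v with u ≟ v | v ≟ u
  ... | yes _ | yes _ = refl
  ... | yes p | no q = ⊥-elim (q (sym p))
  ... | no p | yes q = ⊥-elim (p (sym q))
  ... | no _ | no _ rewrite adj-sym G u v = refl
  i : ∀ u → a u u ≡ false
  i u with u ≟ u
  ... | yes _ = refl
  ... | no p = ⊥-elim (p refl)

data Reach {n : ℕ} (G : Graph n) (S : Subset n) : Fin n → Fin n → Set where
  here : ∀ {u} → u ∈ S → Reach G S u u
  step : ∀ {u w v} → u ∈ S → adj G u w ≡ true → Reach G S w v → Reach G S u v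

Connected : ∀ {n} → Graph n → Subset n → Set
Connected G S = Nonempty S × (∀ u v → u ∈ S → v ∈ S → Reach G S u v)

ConnectedOfSize : ∀ {n} → Graph n → ℕ → Subset n → Set
ConnectedOfSize G k S = ∣ S ∣ ≡ k × Connected G S

-- IsCount P m : exactly m vertex subsets satisfy P
-- (witnessed by a duplicate-free list of precisely the subsets satisfying P).
IsCount : ∀ {n} → (Subset n → Set) → ℕ → Set
IsCount {n} P m =
  Σ (List (Subset n)) λ xs → Unique xs × length xs ≡ m × (∀ S → (S L.∈ xs) ⇔ P S)

IsEtaK : ∀ {n} → Graph n → ℕ → ℕ → Set
IsEtaK G k m = IsCount (ConnectedOfSize G k) m

IsEta : ∀ {n} → Graph n → ℕ → Set
IsEta G m = IsCount (Connected G) m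

HasInducedPathOfLength≥3 : ∀ {n} → Graph n → Set
HasInducedPathOfLength≥3 {n} G =
  Σ ℕ λ ℓ → 3 ≤ ℓ × Σ (Fin (suc ℓ) → Fin n) λ f → Injective _≡_ _≡_ f ×
    (∀ i j → (adj G (f i) (f j) ≡ true) ⇔ (toℕ i ≡ suc (toℕ j) ⊎ toℕ j ≡ suc (toℕ i)))

module Submission where

-- Write [X] for the indicator of a property X of a vertex set S.  The argument is
-- set by set, then summed over all subsets of Fin n:
--  * every nonempty S is connected in G or in Ḡ (connected-or-co-connected);
--    summed over the k-sets this gives the bound on η_k;
--  * call S biconnected if |S| ≥ 2 and S is connected both in G and in Ḡ.  Then
--      [G[S] connected] + [Ḡ[S] connected] = baseline |S| + [S biconnected]
--    with baseline 0 = 0, baseline 1 = 2 and baseline m = 1 otherwise, so that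
--      η(G) + η(Ḡ) = 2ⁿ + n - 1 + #{S : S biconnected}      (η-decomposition);
--  * by Seinsche's theorem a biconnected set contains an induced P4 (seinsche, via
--    the key lemma SeparatingVertex); conversely the vertex set of an induced P4 is
--    biconnected, and P4 is self-complementary.  Hence equality holds iff G (or Ḡ)
--    has no induced P4, i.e. no induced path of length ≥ 3.
-- Counts are sums of indicators over the explicit list of all subsets, and
-- connectivity of an induced subgraph is decided by iterating a neighbourhood closure.

open import Defs

open import Data.Nat using (ℕ; zero; suc; _+_; _∸_; _^_; _≤_; _<_; z≤n; s≤s; z<s)
import Data.Nat as ℕ
open import Data.Nat.Properties hiding (_≟_)
open import Data.Nat.Combinatorics using (_C_; nC1≡n; nCk+nC[k+1]≡[n+1]C[k+1])
open import Data.Nat.ListAction using (sum)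
open import Data.Nat.ListAction.Properties using (sum-++)
open import Data.Bool using (Bool; true; false; not)
open import Data.Bool.Properties using (¬-not; not-involutive) renaming (_≟_ to _≟ᵇ_)
open import Data.Empty using (⊥-elim)
open import Data.Product using (Σ; _×_; _,_; proj₁; proj₂; ∃)
open import Data.Sum using (_⊎_; inj₁; inj₂; [_,_]′)
import Data.Sum
open import Function using (_⇔_; _∘_; mk⇔; Equivalence)
import Function.Properties.Equivalence as ⇔
open import Relation.Binary.PropositionalEquality
open import Relation.Nullary using (¬_; Dec; yes; no; contradiction; ¬?)
open import Relation.Nullary.Decidable using (does; _×-dec_; _⊎-dec_; _→-dec_; decidable-stable; dec-true)
open import Relation.Unary using (Decidable)

open import Data.Fin using (Fin; zero; suc; toℕ; _≟_)
open import Data.Fin.Properties using (any?; all?; ¬∀⟶∃¬)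
open import Data.Fin.Patterns using (0F; 1F; 2F; 3F)
open import Data.Fin.Subset using (Subset; inside; outside; _∈_; _∉_; ∣_∣; Nonempty; ⁅_⁆; _∪_; _-_; _─_; _⊂_)
open import Data.Fin.Subset.Properties
open import Data.Fin.Subset.Induction using (⊂-wellFounded; Acc; acc)

open import Data.Vec using (Vec; []; _∷_; here; there; tabulate; lookup)
open import Data.Vec.Properties using (∷-injectiveʳ; lookup∘tabulate; []=⇒lookup; lookup⇒[]=)
open import Data.Vec.Relation.Unary.All using ([]; _∷_)
open import Data.Vec.Relation.Unary.AllPairs using ([]; _∷_)
open import Data.Vec.Relation.Unary.Unique.Propositional using () renaming (Unique to UniqueV)
open import Data.Vec.Relation.Unary.Unique.Propositional.Properties using (lookup-injective)

open import Data.List using (List; []; _∷_; length; map; filter; _++_)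
open import Data.List.Properties using (map-++; map-∘)
open import Data.List.Membership.Propositional using () renaming (_∈_ to _∈ˡ_)
open import Data.List.Membership.Propositional.Properties
  using (∈-++⁺ˡ; ∈-++⁺ʳ; ∈-map⁺; ∈-map⁻; ∈-filter⁺; ∈-filter⁻)
open import Data.List.Membership.Propositional.Properties.WithK using (unique∧set⇒bag)
import Data.List.Relation.Unary.All as All
import Data.List.Relation.Unary.AllPairs as AllPairs
import Data.List.Relation.Unary.Any as Any
open import Data.List.Relation.Unary.Unique.Propositional using (Unique)
import Data.List.Relation.Unary.Unique.Propositional.Properties as UniqueP
open import Data.List.Relation.Binary.BagAndSetEquality using (∼bag⇒↭)
open import Data.List.Relation.Binary.Permutation.Propositional.Properties using (↭-length)

𝟙 : ∀ {p} {P : Set p} → Dec P → ℕ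
𝟙 (yes _) = 1
𝟙 (no _)  = 0

𝟙-yes : ∀ {p} {P : Set p} (d : Dec P) → P → 𝟙 d ≡ 1
𝟙-yes (yes _) _ = refl
𝟙-yes (no ¬p) p = contradiction p ¬p

𝟙-no : ∀ {p} {P : Set p} (d : Dec P) → ¬ P → 𝟙 d ≡ 0
𝟙-no (yes p) ¬p = contradiction p ¬p
𝟙-no (no _)  _  = refl

𝟙-⇔ : ∀ {p q} {P : Set p} {Q : Set q} (d : Dec P) (e : Dec Q) → (P → Q) → (Q → P) → 𝟙 d ≡ 𝟙 e
𝟙-⇔ (yes _) (yes _) _ _ = refl
𝟙-⇔ (yes p) (no ¬q) f _ = contradiction (f p) ¬q
𝟙-⇔ (no ¬p) (yes q) _ g = contradiction (g q) ¬p
𝟙-⇔ (no _)  (no _)  _ _ = refl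

𝟙-≤-+ : ∀ {p q r} {P : Set p} {Q : Set q} {R : Set r} (d : Dec P) (e : Dec Q) (f : Dec R) →
        (P → Q ⊎ R) → 𝟙 d ≤ 𝟙 e + 𝟙 f
𝟙-≤-+ (no _)  _       _       _ = z≤n
𝟙-≤-+ (yes _) (yes _) _       _ = s≤s z≤n
𝟙-≤-+ (yes _) (no _)  (yes _) _ = s≤s z≤n
𝟙-≤-+ (yes p) (no ¬q) (no ¬r) h = ⊥-elim ([ ¬q , ¬r ]′ (h p))

𝟙-both : ∀ {p q b} {P : Set p} {Q : Set q} {B : Set b} (d : Dec P) (e : Dec Q) (f : Dec B) →
         (P × Q → B) → (B → P × Q) → P ⊎ Q → 𝟙 d + 𝟙 e ≡ 1 + 𝟙 f
𝟙-both (yes p) (yes q) f both _      _ = cong suc (sym (𝟙-yes f (both (p , q))))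
𝟙-both (yes _) (no ¬q) f _    parts  _ = cong suc (sym (𝟙-no f (¬q ∘ proj₂ ∘ parts)))
𝟙-both (no ¬p) (yes _) f _    parts  _ = cong suc (sym (𝟙-no f (¬p ∘ proj₁ ∘ parts)))
𝟙-both (no ¬p) (no ¬q) _ _    _      h = ⊥-elim ([ ¬p , ¬q ]′ h)

module _ {A : Set} where

  sum-map-cong : (xs : List A) {f g : A → ℕ} → (∀ x → f x ≡ g x) → sum (map f xs) ≡ sum (map g xs)
  sum-map-cong []       _  = refl
  sum-map-cong (x ∷ xs) eq = cong₂ _+_ (eq x) (sum-map-cong xs eq)

  sum-map-mono : (xs : List A) {f g : A → ℕ} → (∀ x → f x ≤ g x) → sum (map f xs) ≤ sum (map g xs)
  sum-map-mono []       _  = z≤n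
  sum-map-mono (x ∷ xs) le = +-mono-≤ (le x) (sum-map-mono xs le)

  sum-map-+ : (xs : List A) (f g : A → ℕ) →
              sum (map (λ x → f x + g x) xs) ≡ sum (map f xs) + sum (map g xs)
  sum-map-+ []       f g = refl
  sum-map-+ (x ∷ xs) f g = begin
    (f x + g x) + sum (map (λ y → f y + g y) xs) ≡⟨ cong (f x + g x +_) (sum-map-+ xs f g) ⟩
    (f x + g x) + (sum (map f xs) + sum (map g xs)) ≡⟨ +-interchange (f x) (g x) _ _ ⟩
    (f x + sum (map f xs)) + (g x + sum (map g xs)) ∎
    where open ≡-Reasoning
          open import Algebra.Properties.CommutativeSemigroup +-commutativeSemigroup
            using () renaming (interchange to +-interchange)

  sum-map-zero : (xs : List A) {f : A → ℕ} → (∀ x → f x ≡ 0) → sum (map f xs) ≡ 0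
  sum-map-zero []       _  = refl
  sum-map-zero (x ∷ xs) z0 = cong₂ _+_ (z0 x) (sum-map-zero xs z0)

  sum-map-zero⁻ : (xs : List A) (f : A → ℕ) → sum (map f xs) ≡ 0 → ∀ {x} → x ∈ˡ xs → f x ≡ 0
  sum-map-zero⁻ (y ∷ xs) f s0 (Any.here refl) = m+n≡0⇒m≡0 (f y) s0
  sum-map-zero⁻ (y ∷ xs) f s0 (Any.there m)   = sum-map-zero⁻ xs f (m+n≡0⇒n≡0 (f y) s0) m

subsets : (n : ℕ) → List (Subset n)
subsets zero    = [] ∷ []
subsets (suc n) = map (inside ∷_) (subsets n) ++ map (outside ∷_) (subsets n)

∈-subsets : ∀ {n} (S : Subset n) → S ∈ˡ subsets n
∈-subsets []            = Any.here refl
∈-subsets (true ∷ S)  = ∈-++⁺ˡ (∈-map⁺ (inside ∷_) (∈-subsets S))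
∈-subsets (false ∷ S) = ∈-++⁺ʳ _ (∈-map⁺ (outside ∷_) (∈-subsets S))

subsets-unique : ∀ n → Unique (subsets n)
subsets-unique zero    = All.[] AllPairs.∷ AllPairs.[]
subsets-unique (suc n) =
  UniqueP.++⁺ (UniqueP.map⁺ ∷-injectiveʳ (subsets-unique n))
              (UniqueP.map⁺ ∷-injectiveʳ (subsets-unique n))
              heads-differ
  where
  heads-differ : ∀ {S} → ¬ (S ∈ˡ map (inside ∷_) (subsets n) × S ∈ˡ map (outside ∷_) (subsets n))
  heads-differ (m , m′) with ∈-map⁻ (inside ∷_) m | ∈-map⁻ (outside ∷_) m′
  ... | _ , _ , refl | _ , _ , ()

∑ : (n : ℕ) → (Subset n → ℕ) → ℕ
∑ n f = sum (map f (subsets n))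

∑-cong : ∀ n {f g : Subset n → ℕ} → (∀ S → f S ≡ g S) → ∑ n f ≡ ∑ n g
∑-cong n = sum-map-cong (subsets n)

∑-mono : ∀ n {f g : Subset n → ℕ} → (∀ S → f S ≤ g S) → ∑ n f ≤ ∑ n g
∑-mono n = sum-map-mono (subsets n)

∑-+ : ∀ n (f g : Subset n → ℕ) → ∑ n (λ S → f S + g S) ≡ ∑ n f + ∑ n g
∑-+ n = sum-map-+ (subsets n)

∑-suc : ∀ n (f : Subset (suc n) → ℕ) → ∑ (suc n) f ≡ ∑ n (f ∘ (inside ∷_)) + ∑ n (f ∘ (outside ∷_))
∑-suc n f = begin
  sum (map f (map (inside ∷_) (subsets n) ++ map (outside ∷_) (subsets n)))
    ≡⟨ cong sum (map-++ f (map (inside ∷_) (subsets n)) _) ⟩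
  sum (map f (map (inside ∷_) (subsets n)) ++ map f (map (outside ∷_) (subsets n)))
    ≡⟨ sum-++ (map f (map (inside ∷_) (subsets n))) _ ⟩
  sum (map f (map (inside ∷_) (subsets n))) + sum (map f (map (outside ∷_) (subsets n)))
    ≡⟨ sym (cong₂ _+_ (cong sum (map-∘ (subsets n))) (cong sum (map-∘ (subsets n)))) ⟩
  ∑ n (f ∘ (inside ∷_)) + ∑ n (f ∘ (outside ∷_)) ∎
  where open ≡-Reasoning

∑-one : ∀ n → ∑ n (λ _ → 1) ≡ 2 ^ n
∑-one zero    = refl
∑-one (suc n) = begin
  ∑ (suc n) (λ _ → 1)           ≡⟨ ∑-suc n (λ _ → 1) ⟩
  ∑ n (λ _ → 1) + ∑ n (λ _ → 1) ≡⟨ cong₂ _+_ (∑-one n) (trans (∑-one n) (sym (+-identityʳ _))) ⟩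
  2 ^ n + (2 ^ n + 0)           ∎
  where open ≡-Reasoning

HasSize? : ∀ {n} (k : ℕ) (S : Subset n) → Dec (∣ S ∣ ≡ k)
HasSize? k S = ∣ S ∣ ℕ.≟ k

∑-size : ∀ n k → ∑ n (λ S → 𝟙 (HasSize? k S)) ≡ n C k
∑-size zero    zero    = refl
∑-size zero    (suc k) = refl
∑-size (suc n) zero    = begin
  ∑ (suc n) (λ S → 𝟙 (HasSize? 0 S))
    ≡⟨ ∑-suc n _ ⟩
  ∑ n (λ S → 𝟙 (HasSize? 0 (inside ∷ S))) + ∑ n (λ S → 𝟙 (HasSize? 0 S))
    ≡⟨ cong₂ _+_ (sum-map-zero (subsets n) (λ S → 𝟙-no (HasSize? 0 (inside ∷ S)) λ ())) (∑-size n 0) ⟩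
  1 ∎
  where open ≡-Reasoning
∑-size (suc n) (suc k) = begin
  ∑ (suc n) (λ S → 𝟙 (HasSize? (suc k) S))
    ≡⟨ ∑-suc n _ ⟩
  ∑ n (λ S → 𝟙 (HasSize? (suc k) (inside ∷ S))) + ∑ n (λ S → 𝟙 (HasSize? (suc k) S))
    ≡⟨ cong (_+ ∑ n (λ S → 𝟙 (HasSize? (suc k) S))) (∑-cong n λ S →
         𝟙-⇔ (HasSize? (suc k) (inside ∷ S)) (HasSize? k S) suc-injective (cong suc)) ⟩
  ∑ n (λ S → 𝟙 (HasSize? k S)) + ∑ n (λ S → 𝟙 (HasSize? (suc k) S))
    ≡⟨ cong₂ _+_ (∑-size n k) (∑-size n (suc k)) ⟩
  n C k + n C suc k
    ≡⟨ nCk+nC[k+1]≡[n+1]C[k+1] n k ⟩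
  suc n C suc k ∎
  where open ≡-Reasoning

length-filter-𝟙 : ∀ {A : Set} {P : A → Set} (P? : Decidable P) (xs : List A) →
                  length (filter P? xs) ≡ sum (map (λ x → 𝟙 (P? x)) xs)
length-filter-𝟙 P? []       = refl
length-filter-𝟙 P? (x ∷ xs) with P? x
... | yes _ = cong suc (length-filter-𝟙 P? xs)
... | no _  = length-filter-𝟙 P? xs

unique-length : ∀ {A : Set} {xs ys : List A} → Unique xs → Unique ys →
                (∀ z → z ∈ˡ xs ⇔ z ∈ˡ ys) → length xs ≡ length ys
unique-length uxs uys same = ↭-length (∼bag⇒↭ (unique∧set⇒bag uxs uys λ {z} → same z))

IsCount⇒∑ : ∀ {n} {P : Subset n → Set} (P? : Decidable P) {m} → IsCount P m → m ≡ ∑ n (λ S → 𝟙 (P? S))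
IsCount⇒∑ {n} P? (xs , uxs , refl , spec) =
  trans (unique-length uxs (UniqueP.filter⁺ P? {xs = subsets n} (subsets-unique n)) same)
        (length-filter-𝟙 P? (subsets n))
  where
  same : ∀ S → S ∈ˡ xs ⇔ S ∈ˡ filter P? (subsets n)
  same S = mk⇔ (λ m → ∈-filter⁺ P? (∈-subsets S) (Equivalence.to (spec S) m))
               (λ m → Equivalence.from (spec S) (proj₂ (∈-filter⁻ P? {xs = subsets n} m)))

count : ∀ {n} {P : Subset n → Set} → Decidable P → Σ ℕ (IsCount P)
count {n} P? = _ , filter P? (subsets n) , UniqueP.filter⁺ P? {xs = subsets n} (subsets-unique n) , refl ,
               λ S → mk⇔ (λ m → proj₂ (∈-filter⁻ P? {xs = subsets n} m)) (∈-filter⁺ P? (∈-subsets S))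

adjacent⇒distinct : ∀ {n} (G : Graph n) {u v} → adj G u v ≡ true → u ≢ v
adjacent⇒distinct G {u} uv refl with () ← trans (sym uv) (adj-irrefl G u)

-- The relation is symmetric, which lets every argument about G and its complement
-- be run with the roles exchanged (the complement of the complement is not G on the nose).
record Complementary {n} (K G : Graph n) : Set where
  field flip : ∀ {u v} → u ≢ v → adj K u v ≡ not (adj G u v)
open Complementary

complement-complementary : ∀ {n} (G : Graph n) → Complementary (complement G) G
complement-complementary G .flip {u} {v} u≢v with u ≟ v
... | yes u≡v = contradiction u≡v u≢v
... | no _    = refl

complementary-sym : ∀ {n} {K G : Graph n} → Complementary K G → Complementary G K
complementary-sym {G = G} K∁G .flip {u} {v} u≢v =
  trans (sym (not-involutive (adj G u v))) (cong not (sym (K∁G .flip u≢v)))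

module _ {n} {K G : Graph n} (K∁G : Complementary K G) where

  gain-edge : ∀ {u v} → u ≢ v → adj G u v ≡ false → adj K u v ≡ true
  gain-edge u≢v uv = trans (K∁G .flip u≢v) (cong not uv)

  lose-edge : ∀ {u v} → adj G u v ≡ true → adj K u v ≡ false
  lose-edge uv = trans (K∁G .flip (adjacent⇒distinct G uv)) (cong not uv)

select : ∀ {n} {P : Fin n → Set} → Decidable P → Subset n
select P? = tabulate (does ∘ P?)

∈-select⁺ : ∀ {n} {P : Fin n → Set} (P? : Decidable P) {w} → P w → w ∈ select P?
∈-select⁺ P? {w} p = lookup⇒[]= w _ (trans (lookup∘tabulate (does ∘ P?) w) (dec-true (P? w) p))

∈-select⁻ : ∀ {n} {P : Fin n → Set} (P? : Decidable P) {w} → w ∈ select P? → P w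
∈-select⁻ P? {w} w∈ with P? w | trans (sym (lookup∘tabulate (does ∘ P?) w)) ([]=⇒lookup w∈)
... | yes p | _  = p
... | no _  | ()

module _ {n} (G : Graph n) (S : Subset n) where

  reach-start : ∀ {u v} → Reach G S u v → u ∈ S
  reach-start (here u∈S)     = u∈S
  reach-start (step u∈S _ _) = u∈S

  reach-end : ∀ {u v} → Reach G S u v → v ∈ S
  reach-end (here v∈S)   = v∈S
  reach-end (step _ _ r) = reach-end r

  reach-snoc : ∀ {u x w} → Reach G S u x → adj G x w ≡ true → w ∈ S → Reach G S u w
  reach-snoc (here x∈S)       xw w∈S = step x∈S xw (here w∈S)
  reach-snoc (step u∈S uy r)  xw w∈S = step u∈S uy (reach-snoc r xw w∈S)

  reach-trans : ∀ {u x v} → Reach G S u x → Reach G S x v → Reach G S u v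
  reach-trans (here _)       r′ = r′
  reach-trans (step u∈S uw r) r′ = step u∈S uw (reach-trans r r′)

  reach-sym : ∀ {u v} → Reach G S u v → Reach G S v u
  reach-sym (here u∈S)                   = here u∈S
  reach-sym (step {u} {w} u∈S uw r) = reach-snoc (reach-sym r) (trans (adj-sym G w u) uw) u∈S

  reach-edge : ∀ {u v} → u ∈ S → v ∈ S → adj G u v ≡ true → Reach G S u v
  reach-edge u∈S v∈S uv = step u∈S uv (here v∈S)

  first-step : ∀ {v y} → Reach G S v y → v ≢ y → Σ (Fin n) λ u → u ∈ S × adj G v u ≡ true
  first-step (here _)       v≢y = contradiction refl v≢y
  first-step (step _ vu r) _   = _ , reach-start r , vu

  hub⇒connected : ∀ {h} → h ∈ S → (∀ v → v ∈ S → Reach G S h v) → Connected G S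
  hub⇒connected h∈S hub = (_ , h∈S) , λ u v u∈S v∈S → reach-trans (reach-sym (hub u u∈S)) (hub v v∈S)

-- The vertices reachable from u are the
-- limit of  R₀ = {u},  Rₘ₊₁ = Rₘ ∪ {w ∈ S adjacent to some vertex of Rₘ};
-- the sequence grows strictly until it stabilises, so Rₙ is already closed.
module Closure {n} (G : Graph n) (S : Subset n) where

  Frontier : Subset n → Fin n → Set
  Frontier R w = w ∈ S × ∃ λ x → x ∈ R × adj G x w ≡ true

  frontier? : ∀ R w → Dec (Frontier R w)
  frontier? R w = (w ∈? S) ×-dec any? (λ x → (x ∈? R) ×-dec (adj G x w ≟ᵇ true))

  grow : Subset n → Subset n
  grow R = R ∪ select (frontier? R)

  stable-or-grows : ∀ R → grow R ≡ R ⊎ R ⊂ grow R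
  stable-or-grows R with any? (λ x → (x ∈? grow R) ×-dec ¬? (x ∈? R))
  ... | yes (x , x∈ , x∉) = inj₂ (p⊆p∪q _ , x , x∈ , x∉)
  ... | no none = inj₁ (⊆-antisym (λ {x} x∈ → decidable-stable (x ∈? R) (λ x∉ → none (x , x∈ , x∉)))
                                  (p⊆p∪q _))

  ball : Fin n → ℕ → Subset n
  ball u zero    = ⁅ u ⁆
  ball u (suc m) = grow (ball u m)

  stable-or-large : ∀ u m → ball u (suc m) ≡ ball u m ⊎ m < ∣ ball u m ∣
  stable-or-large u zero = inj₂ (subst (0 <_) (sym (∣⁅x⁆∣≡1 u)) (s≤s z≤n))
  stable-or-large u (suc m) with stable-or-large u m
  ... | inj₁ same = inj₁ (cong grow same)
  ... | inj₂ big with stable-or-grows (ball u m)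
  ...   | inj₁ same = inj₁ (cong grow same)
  ...   | inj₂ grew = inj₂ (≤-trans (s≤s big) (p⊂q⇒∣p∣<∣q∣ grew))

  ball-stable : ∀ u → grow (ball u n) ≡ ball u n
  ball-stable u with stable-or-large u n
  ... | inj₁ same = same
  ... | inj₂ big  = contradiction (∣p∣≤n (ball u n)) (<⇒≱ big)

  ball-sound : ∀ u m {w} → u ∈ S → w ∈ ball u m → Reach G S u w
  ball-sound u zero    u∈S w∈ rewrite x∈⁅y⁆⇒x≡y u w∈ = here u∈S
  ball-sound u (suc m) u∈S w∈ with x∈p∪q⁻ (ball u m) _ w∈
  ... | inj₁ w∈B                  = ball-sound u m u∈S w∈B
  ... | inj₂ w∈F with w∈S , x , x∈B , xw ← ∈-select⁻ (frontier? (ball u m)) w∈F =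
    reach-snoc G S (ball-sound u m u∈S x∈B) xw w∈S

  ball-centre : ∀ u m → u ∈ ball u m
  ball-centre u zero    = x∈⁅x⁆ u
  ball-centre u (suc m) = p⊆p∪q _ (ball-centre u m)

  ball-complete : ∀ u {x v} → Reach G S x v → x ∈ ball u n → v ∈ ball u n
  ball-complete u (here _)       x∈ = x∈
  ball-complete u (step _ xw r) x∈ = ball-complete u r (subst (_ ∈_) (ball-stable u) next∈)
    where next∈ = q⊆p∪q (ball u n) _ (∈-select⁺ (frontier? (ball u n)) (reach-start G S r , _ , x∈ , xw))

  reach? : ∀ u v → Dec (Reach G S u v)
  reach? u v with u ∈? S
  ... | no u∉S = no (u∉S ∘ reach-start G S)
  ... | yes u∈S with v ∈? ball u n
  ...   | yes v∈ = yes (ball-sound u n u∈S v∈)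
  ...   | no  v∉ = no (λ r → v∉ (ball-complete u r (ball-centre u n)))

open Closure using (reach?)

connected? : ∀ {n} (G : Graph n) (S : Subset n) → Dec (Connected G S)
connected? G S = nonempty? S ×-dec all? (λ u → all? (λ v → (u ∈? S) →-dec ((v ∈? S) →-dec reach? G S u v)))

reachable-or-cut : ∀ {n} (G : Graph n) (S : Subset n) {u} → u ∈ S →
                   Connected G S ⊎ Σ (Fin n) λ y → y ∈ S × ¬ Reach G S u y
reachable-or-cut {n} G S {u} u∈S with all? (λ y → (y ∈? S) →-dec reach? G S u y)
... | yes all = inj₁ (hub⇒connected G S u∈S all)
... | no ¬all with y , ¬r ← ¬∀⟶∃¬ n _ (λ y → (y ∈? S) →-dec reach? G S u y) ¬all =
  inj₂ (y , decidable-stable (y ∈? S) (λ y∉S → ¬r λ y∈S → contradiction y∈S y∉S) , λ r → ¬r λ _ → r)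

member⇒size-pos : ∀ {n} {S : Subset n} {x} → x ∈ S → 0 < ∣ S ∣
member⇒size-pos here                    = z<s
member⇒size-pos {S = b ∷ S} (there x∈S) = ≤-trans (member⇒size-pos x∈S) (∣p∣≤∣x∷p∣ b S)

size-pos⇒nonempty : ∀ {n} (S : Subset n) → 0 < ∣ S ∣ → Nonempty S
size-pos⇒nonempty (true ∷ S)  _   = zero , here
size-pos⇒nonempty (false ∷ S) pos with x , x∈S ← size-pos⇒nonempty S pos = suc x , there x∈S

distinct⇒size≥2 : ∀ {n} {S : Subset n} {x y} → x ≢ y → x ∈ S → y ∈ S → 2 ≤ ∣ S ∣
distinct⇒size≥2 {S = S} x≢y x∈S y∈S =
  ≤-trans (s≤s (member⇒size-pos (x∈p∧x≢y⇒x∈p-y y∈S (x≢y ∘ sym)))) (x∈p⇒∣p-x∣<∣p∣ x∈S)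

size≥2⇒distinct : ∀ {n} (S : Subset n) → 2 ≤ ∣ S ∣ → Σ (Fin n) λ x → Σ (Fin n) λ y → x ≢ y × x ∈ S × y ∈ S
size≥2⇒distinct (true ∷ S) (s≤s pos) with y , y∈S ← size-pos⇒nonempty S pos = zero , suc y , (λ ()) , here , there y∈S
size≥2⇒distinct (false ∷ S) two with x , y , x≢y , x∈S , y∈S ← size≥2⇒distinct S two =
  suc x , suc y , x≢y ∘ Data.Fin.Properties.suc-injective , there x∈S , there y∈S

size0⇒disconnected : ∀ {n} (K : Graph n) {S : Subset n} → ∣ S ∣ ≡ 0 → ¬ Connected K S
size0⇒disconnected K s0 ((x , x∈S) , _) with () ← subst (0 <_) s0 (member⇒size-pos x∈S)

size1⇒connected : ∀ {n} (K : Graph n) (S : Subset n) → ∣ S ∣ ≡ 1 → Connected K S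
size1⇒connected K S s1 with x , x∈S ← size-pos⇒nonempty S (subst (0 <_) (sym s1) z<s) =
  hub⇒connected K S x∈S only-x
  where
  only-x : ∀ v → v ∈ S → Reach K S x v
  only-x v v∈S with x ≟ v
  ... | yes refl = here x∈S
  ... | no x≢v with s≤s () ← subst (2 ≤_) s1 (distinct⇒size≥2 x≢v x∈S v∈S)

-- If y ∈ S is not reachable from x, every vertex p ∈ S reaches y in the complement:
-- directly if p is reachable from x, and through x otherwise.
connected-or-co-connected : ∀ {n} (G : Graph n) (S : Subset n) → Nonempty S →
                            Connected G S ⊎ Connected (complement G) S
connected-or-co-connected G S (x , x∈S) with reachable-or-cut G S x∈S
... | inj₁ conn           = inj₁ conn
... | inj₂ (y , y∈S , x↛y) = inj₂ (hub⇒connected Ḡ S y∈S λ p p∈S → reach-sym Ḡ S (to-y p p∈S))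
  where
  Ḡ = complement G
  cut-edge : ∀ {p q} → Reach G S x p → ¬ Reach G S x q → q ∈ S → adj Ḡ p q ≡ true
  cut-edge x→p x↛q q∈S =
    gain-edge (complement-complementary G) (λ { refl → x↛q x→p })
              (¬-not λ pq → x↛q (reach-snoc G S x→p pq q∈S))
  to-y : ∀ p → p ∈ S → Reach Ḡ S p y
  to-y p p∈S with reach? G S x p
  ... | yes x→p = reach-edge Ḡ S p∈S y∈S (cut-edge x→p x↛y y∈S)
  ... | no  x↛p = step p∈S (trans (adj-sym Ḡ p x) (cut-edge (here x∈S) x↛p p∈S))
                           (reach-edge Ḡ S x∈S y∈S (cut-edge (here x∈S) x↛y y∈S))

record P4 {n} (G : Graph n) (a b c d : Fin n) : Set where
  field
    ab : adj G a b ≡ true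
    bc : adj G b c ≡ true
    cd : adj G c d ≡ true
    ac : adj G a c ≡ false
    bd : adj G b d ≡ false
    ad : adj G a d ≡ false

HasP4 : ∀ {n} → Graph n → Set
HasP4 {n} G = Σ (Fin n) λ a → Σ (Fin n) λ b → Σ (Fin n) λ c → Σ (Fin n) λ d → P4 G a b c d

adj-swap : ∀ {n} (G : Graph n) {u v b} → adj G u v ≡ b → adj G v u ≡ b
adj-swap G {u} {v} uv = trans (adj-sym G v u) uv

module P4-distinct {n} {G : Graph n} {a b c d} (p : P4 G a b c d) where
  open P4 p

  true≢false : ∀ {x : Bool} → x ≡ true → x ≢ false
  true≢false refl ()

  a≢b : a ≢ b
  a≢b = adjacent⇒distinct G ab
  b≢c : b ≢ c
  b≢c = adjacent⇒distinct G bc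
  c≢d : c ≢ d
  c≢d = adjacent⇒distinct G cd
  a≢c : a ≢ c
  a≢c refl = true≢false cd ad
  b≢d : b ≢ d
  b≢d refl = true≢false ab ad
  a≢d : a ≢ d
  a≢d refl = true≢false cd (adj-swap G ac)

P4-flip : ∀ {n} {K G : Graph n} {a b c d} → Complementary K G → P4 G a b c d → P4 K b d a c
P4-flip {G = G} K∁G p = record
  { ab = gain-edge K∁G b≢d bd
  ; bc = gain-edge K∁G (a≢d ∘ sym) (adj-swap G ad)
  ; cd = gain-edge K∁G a≢c ac
  ; ac = lose-edge K∁G (adj-swap G ab)
  ; bd = lose-edge K∁G (adj-swap G cd)
  ; ad = lose-edge K∁G bc
  }
  where open P4 p
        open P4-distinct p

HasP4-flip : ∀ {n} {K G : Graph n} → Complementary K G → HasP4 G → HasP4 K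
HasP4-flip K∁G (a , b , c , d , p) = b , d , a , c , P4-flip K∁G p

x∈p-y⇒x≢y : ∀ {n} (p : Subset n) {x y} → x ∈ p - y → x ≢ y
x∈p-y⇒x≢y p {x} {y} x∈ refl = excluded p ⁅ y ⁆ x∈ (x∈⁅x⁆ y)
  where
  excluded : ∀ {m} (p q : Subset m) {x} → x ∈ p ─ q → x ∉ q
  excluded (_ ∷ p) (_ ∷ q)    (there x∈) (there x∈q) = excluded p q x∈ x∈q
  excluded (_ ∷ p) (true ∷ q) ()          here

-- Let G[S] be connected, v ∈ S, and u ∈ S - v a non-neighbour of v,
-- and suppose G[S - v] is disconnected, say y ∈ S - v is not reachable from u
-- there.  Walking from y to v inside S, the vertex z just before the first visit
-- of v is a neighbour of v outside the component C of u in G[S - v]; walking from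
-- u to v, the first vertex w adjacent to v and its predecessor u′ lie in C.
-- Then u′ – w – v – z is an induced path.
module SeparatingVertex {n} (G : Graph n) (S : Subset n) {v u} (v∈S : v ∈ S) (u∈S′ : u ∈ S - v)
                        (vu : adj G v u ≡ false) (conn : Connected G S) where

  S′ : Subset n
  S′ = S - v

  InC : Fin n → Set
  InC = Reach G S′ u

  walk-to-v : ∀ x → x ∈ S′ → Reach G S x v
  walk-to-v x x∈S′ = proj₂ conn x v (p─q⊆p S ⁅ v ⁆ x∈S′) v∈S

  enter-S′ : ∀ {x} → Reach G S x v → x ≢ v → x ∈ S′
  enter-S′ r x≢v = x∈p∧x≢y⇒x∈p-y (reach-start G S r) x≢v

  neighbour-outside-C : ∀ {y} → Reach G S y v → y ∈ S′ → ¬ InC y →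
                        Σ (Fin n) λ z → z ∈ S′ × ¬ InC z × adj G z v ≡ true
  neighbour-outside-C (here _) y∈S′ _ = contradiction refl (x∈p-y⇒x≢y S y∈S′)
  neighbour-outside-C {y} (step {w = w} _ yw r) y∈S′ y∉C with w ≟ v
  ... | yes refl = y , y∈S′ , y∉C , yw
  ... | no w≢v   = neighbour-outside-C r (enter-S′ r w≢v)
                     (λ w∈C → y∉C (reach-snoc G S′ w∈C (adj-swap G yw) y∈S′))

  edge-into-N[v] : ∀ {x} → Reach G S x v → InC x → adj G x v ≡ false →
                   Σ (Fin n) λ u′ → Σ (Fin n) λ w → InC u′ × InC w ×
                     adj G u′ w ≡ true × adj G u′ v ≡ false × adj G w v ≡ true
  edge-into-N[v] (here _) x∈C _ = contradiction refl (x∈p-y⇒x≢y S (reach-end G S′ x∈C))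
  edge-into-N[v] {x} (step {w = w} _ xw r) x∈C xv with w ≟ v | adj G w v in wv
  ... | yes refl | _     with () ← trans (sym xw) xv
  ... | no w≢v   | true  = x , w , x∈C , w∈C , xw , xv , wv
    where w∈C = reach-snoc G S′ x∈C xw (enter-S′ r w≢v)
  ... | no w≢v   | false = edge-into-N[v] r (reach-snoc G S′ x∈C xw (enter-S′ r w≢v)) wv

  induced-path : ¬ Connected G S′ → HasP4 G
  induced-path disc with reachable-or-cut G S′ u∈S′
  ... | inj₁ conn′ = contradiction conn′ disc
  ... | inj₂ (y , y∈S′ , y∉C)
    with z , z∈S′ , z∉C , zv ← neighbour-outside-C (walk-to-v y y∈S′) y∈S′ y∉C
    with u′ , w , u′∈C , w∈C , u′w , u′v , wv ← edge-into-N[v] (walk-to-v u u∈S′) (here u∈S′) (adj-swap G vu)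
    = u′ , w , v , z , record
      { ab = u′w ; bc = wv ; cd = adj-swap G zv ; ac = u′v
      ; bd = ¬-not λ wz → z∉C (reach-snoc G S′ w∈C wz z∈S′)
      ; ad = ¬-not λ u′z → z∉C (reach-snoc G S′ u′∈C u′z z∈S′)
      }

BiConnected : ∀ {n} → Graph n → Subset n → Set
BiConnected G S = 2 ≤ ∣ S ∣ × Connected G S × Connected (complement G) S

biConnected? : ∀ {n} (G : Graph n) → Decidable (BiConnected G)
biConnected? G S = (2 ℕ.≤? ∣ S ∣) ×-dec connected? G S ×-dec connected? (complement G) S

neighbour∈S-v : ∀ {n} (K : Graph n) {S : Subset n} {v u} → u ∈ S → adj K v u ≡ true → u ∈ S - v
neighbour∈S-v K u∈S vu = x∈p∧x≢y⇒x∈p-y u∈S (adjacent⇒distinct K vu ∘ sym)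

-- Pick v ∈ S; it has a neighbour u₁ and
-- a non-neighbour u₂ in S - v.  If S - v is disconnected in G or in the complement,
-- the key lemma applies (in G, resp. in the complement); otherwise S - v ⊂ S is again
-- biconnected and we recurse.
seinsche : ∀ {n} (G : Graph n) (S : Subset n) → BiConnected G S → HasP4 G
seinsche G S = go S (⊂-wellFounded S)
  where
  Ḡ = complement G
  Ḡ∁G = complement-complementary G
  G∁Ḡ = complementary-sym Ḡ∁G

  go : ∀ S → Acc _⊂_ S → BiConnected G S → HasP4 G
  go S (acc smaller) (two , conn , co-conn)
    with v , y , v≢y , v∈S , y∈S ← size≥2⇒distinct S two
    with u₁ , u₁∈S , vu₁ ← first-step G S (proj₂ conn v y v∈S y∈S) v≢y
    with u₂ , u₂∈S , vu₂ ← first-step Ḡ S (proj₂ co-conn v y v∈S y∈S) v≢y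
    with connected? G (S - v) | connected? Ḡ (S - v)
  ... | no disc | _ =
    SeparatingVertex.induced-path G S v∈S (neighbour∈S-v Ḡ u₂∈S vu₂) (lose-edge G∁Ḡ vu₂) conn disc
  ... | yes _ | no co-disc =
    HasP4-flip G∁Ḡ (SeparatingVertex.induced-path Ḡ S v∈S (neighbour∈S-v G u₁∈S vu₁)
                                                    (lose-edge Ḡ∁G vu₁) co-conn co-disc)
  ... | yes conn′ | yes co-conn′ =
    go (S - v) (smaller (x∈p⇒p-x⊂p v∈S))
       (distinct⇒size≥2 u₁≢u₂ (neighbour∈S-v G u₁∈S vu₁) (neighbour∈S-v Ḡ u₂∈S vu₂) , conn′ , co-conn′)
    where
    u₁≢u₂ : u₁ ≢ u₂
    u₁≢u₂ refl with () ← trans (sym vu₁) (lose-edge G∁Ḡ vu₂)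

path⇒P4 : ∀ {n} {G : Graph n} → HasInducedPathOfLength≥3 G → HasP4 G
path⇒P4 {G = G} (suc (suc (suc ℓ)) , s≤s (s≤s (s≤s _)) , f , _ , spec) =
  f 0F , f 1F , f 2F , f 3F , record
    { ab = edge 0F 1F refl ; bc = edge 1F 2F refl ; cd = edge 2F 3F refl
    ; ac = non-edge 0F 2F (λ { (inj₁ ()) ; (inj₂ ()) })
    ; bd = non-edge 1F 3F (λ { (inj₁ ()) ; (inj₂ ()) })
    ; ad = non-edge 0F 3F (λ { (inj₁ ()) ; (inj₂ ()) })
    }
  where
  Consecutive : Fin (suc (suc (suc (suc ℓ)))) → Fin (suc (suc (suc (suc ℓ)))) → Set
  Consecutive i j = toℕ i ≡ suc (toℕ j) ⊎ toℕ j ≡ suc (toℕ i)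
  edge : ∀ i j → toℕ j ≡ suc (toℕ i) → adj G (f i) (f j) ≡ true
  edge i j next = Equivalence.from (spec i j) (inj₂ next)
  non-edge : ∀ i j → ¬ Consecutive i j → adj G (f i) (f j) ≡ false
  non-edge i j far = ¬-not (far ∘ Equivalence.to (spec i j))

reflects-⇔ : ∀ {p} {P : Set p} {x : Bool} (d : Dec P) → x ≡ does d → (x ≡ true) ⇔ P
reflects-⇔ (yes p) refl = mk⇔ (λ _ → p) (λ _ → refl)
reflects-⇔ (no ¬p) refl = mk⇔ (λ ()) (λ p → contradiction p ¬p)

P4⇒path : ∀ {n} {G : Graph n} → HasP4 G → HasInducedPathOfLength≥3 G
P4⇒path {n} {G} (a , b , c , d , p) =
  3 , s≤s (s≤s (s≤s z≤n)) , lookup vertices , lookup-injective distinct _ _ , adjacency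
  where
  open P4 p
  open P4-distinct p
  vertices : Vec (Fin n) 4
  vertices = a ∷ b ∷ c ∷ d ∷ []
  distinct : UniqueV vertices
  distinct = (a≢b ∷ a≢c ∷ a≢d ∷ []) ∷ (b≢c ∷ b≢d ∷ []) ∷ (c≢d ∷ []) ∷ [] ∷ []
  consecutive? : (i j : Fin 4) → Dec (toℕ i ≡ suc (toℕ j) ⊎ toℕ j ≡ suc (toℕ i))
  consecutive? i j = (toℕ i ℕ.≟ suc (toℕ j)) ⊎-dec (toℕ j ℕ.≟ suc (toℕ i))
  adjacency-table : ∀ i j → adj G (lookup vertices i) (lookup vertices j) ≡ does (consecutive? i j)
  adjacency-table 0F 0F = adj-irrefl G a
  adjacency-table 0F 1F = ab
  adjacency-table 0F 2F = ac
  adjacency-table 0F 3F = ad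
  adjacency-table 1F 0F = adj-swap G ab
  adjacency-table 1F 1F = adj-irrefl G b
  adjacency-table 1F 2F = bc
  adjacency-table 1F 3F = bd
  adjacency-table 2F 0F = adj-swap G ac
  adjacency-table 2F 1F = adj-swap G bc
  adjacency-table 2F 2F = adj-irrefl G c
  adjacency-table 2F 3F = cd
  adjacency-table 3F 0F = adj-swap G ad
  adjacency-table 3F 1F = adj-swap G bd
  adjacency-table 3F 2F = adj-swap G cd
  adjacency-table 3F 3F = adj-irrefl G d
  adjacency : ∀ i j → (adj G (lookup vertices i) (lookup vertices j) ≡ true) ⇔
                      (toℕ i ≡ suc (toℕ j) ⊎ toℕ j ≡ suc (toℕ i))
  adjacency i j = reflects-⇔ (consecutive? i j) (adjacency-table i j)

-- The vertex set of an induced P4 is biconnected: the path itself connects it in G,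
-- and the path b – d – a – c connects it in the complement.
P4⇒biconnected : ∀ {n} {G : Graph n} → HasP4 G → Σ (Subset n) (BiConnected G)
P4⇒biconnected {n} {G} (a , b , c , d , p) =
  S , distinct⇒size≥2 a≢b a∈S b∈S ,
  path-connected G ab bc cd a∈S b∈S c∈S d∈S cover ,
  path-connected (complement G) ab′ bc′ cd′ b∈S d∈S a∈S c∈S (reorder ∘ cover)
  where
  open P4 p
  open P4-distinct p
  open P4 (P4-flip (complement-complementary G) p) using () renaming (ab to ab′; bc to bc′; cd to cd′)

  OneOf : Fin n → Fin n → Fin n → Fin n → Fin n → Set
  OneOf w x y z v = v ≡ w ⊎ v ≡ x ⊎ v ≡ y ⊎ v ≡ z

  one-of? : Decidable (OneOf a b c d)
  one-of? v = (v ≟ a) ⊎-dec (v ≟ b) ⊎-dec (v ≟ c) ⊎-dec (v ≟ d)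

  S : Subset n
  S = select one-of?

  cover : ∀ {v} → v ∈ S → OneOf a b c d v
  cover = ∈-select⁻ one-of?

  a∈S : a ∈ S
  a∈S = ∈-select⁺ one-of? (inj₁ refl)
  b∈S : b ∈ S
  b∈S = ∈-select⁺ one-of? (inj₂ (inj₁ refl))
  c∈S : c ∈ S
  c∈S = ∈-select⁺ one-of? (inj₂ (inj₂ (inj₁ refl)))
  d∈S : d ∈ S
  d∈S = ∈-select⁺ one-of? (inj₂ (inj₂ (inj₂ refl)))

  reorder : ∀ {v} → OneOf a b c d v → OneOf b d a c v
  reorder (inj₁ v≡a)               = inj₂ (inj₂ (inj₁ v≡a))
  reorder (inj₂ (inj₁ v≡b))        = inj₁ v≡b
  reorder (inj₂ (inj₂ (inj₁ v≡c))) = inj₂ (inj₂ (inj₂ v≡c))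
  reorder (inj₂ (inj₂ (inj₂ v≡d))) = inj₂ (inj₁ v≡d)

  path-connected : ∀ K {w x y z} → adj K w x ≡ true → adj K x y ≡ true → adj K y z ≡ true →
                   w ∈ S → x ∈ S → y ∈ S → z ∈ S → (∀ {v} → v ∈ S → OneOf w x y z v) → Connected K S
  path-connected K wx xy yz w∈S x∈S y∈S z∈S onS = hub⇒connected K S w∈S λ v v∈S → from-w (onS v∈S)
    where
    from-w : ∀ {v} → OneOf _ _ _ _ v → Reach K S _ v
    from-w (inj₁ refl)               = here w∈S
    from-w (inj₂ (inj₁ refl))        = step w∈S wx (here x∈S)
    from-w (inj₂ (inj₂ (inj₁ refl))) = step w∈S wx (step x∈S xy (here y∈S))
    from-w (inj₂ (inj₂ (inj₂ refl))) = step w∈S wx (step x∈S xy (step y∈S yz (here z∈S)))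

connectedOfSize? : ∀ {n} (G : Graph n) (k : ℕ) → Decidable (ConnectedOfSize G k)
connectedOfSize? G k S = HasSize? k S ×-dec connected? G S

size-k-covered : ∀ {n} (G : Graph n) {k} → 1 < k → ∀ S →
                 𝟙 (HasSize? k S) ≤ 𝟙 (connectedOfSize? G k S) + 𝟙 (connectedOfSize? (complement G) k S)
size-k-covered G {k} 1<k S =
  𝟙-≤-+ (HasSize? k S) (connectedOfSize? G k S) (connectedOfSize? (complement G) k S) λ size →
    Data.Sum.map (size ,_) (size ,_)
      (connected-or-co-connected G S (size-pos⇒nonempty S (subst (0 <_) (sym size) (<-trans z<s 1<k))))

-- The least possible number of graphs among G, Ḡ in which a set of m vertices is
-- connected: none for m = 0, both for m = 1, and at least one for m ≥ 2.
baseline : ℕ → ℕ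
baseline 0             = 0
baseline 1             = 2
baseline (suc (suc _)) = 1

∑-baseline : ∀ n → ∑ n (λ S → baseline ∣ S ∣) ≡ 2 ^ n + n ∸ 1
∑-baseline n = begin
  ∑ n (λ S → baseline ∣ S ∣)
    ≡⟨ m+n∸n≡m _ 1 ⟨
  ∑ n (λ S → baseline ∣ S ∣) + 1 ∸ 1
    ≡⟨ cong (λ t → ∑ n (λ S → baseline ∣ S ∣) + t ∸ 1) (∑-size n 0) ⟨
  ∑ n (λ S → baseline ∣ S ∣) + ∑ n (𝟙 ∘ HasSize? 0) ∸ 1
    ≡⟨ cong (_∸ 1) (∑-+ n _ _) ⟨
  ∑ n (λ S → baseline ∣ S ∣ + 𝟙 (HasSize? 0 S)) ∸ 1
    ≡⟨ cong (_∸ 1) (∑-cong n (shift ∘ ∣_∣)) ⟩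
  ∑ n (λ S → 1 + 𝟙 (HasSize? 1 S)) ∸ 1
    ≡⟨ cong (_∸ 1) (∑-+ n _ _) ⟩
  ∑ n (λ _ → 1) + ∑ n (𝟙 ∘ HasSize? 1) ∸ 1
    ≡⟨ cong₂ (λ x y → x + y ∸ 1) (∑-one n) (trans (∑-size n 1) (nC1≡n n)) ⟩
  2 ^ n + n ∸ 1 ∎
  where
  open ≡-Reasoning
  shift : ∀ m → baseline m + 𝟙 (m ℕ.≟ 0) ≡ 1 + 𝟙 (m ℕ.≟ 1)
  shift 0             = refl
  shift 1             = refl
  shift (suc (suc m)) = refl

connections : ∀ {n} (G : Graph n) (S : Subset n) →
              𝟙 (connected? G S) + 𝟙 (connected? (complement G) S) ≡ baseline ∣ S ∣ + 𝟙 (biConnected? G S)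
connections G S = by-size ∣ S ∣ refl
  where
  Ḡ = complement G
  small : ∀ {m} → m < 2 → ∣ S ∣ ≡ m → 𝟙 (biConnected? G S) ≡ 0
  small m<2 size = 𝟙-no (biConnected? G S) λ (two , _) → <⇒≱ m<2 (subst (2 ≤_) size two)
  by-size : ∀ m → ∣ S ∣ ≡ m → 𝟙 (connected? G S) + 𝟙 (connected? Ḡ S) ≡ baseline m + 𝟙 (biConnected? G S)
  by-size 0 size =
    trans (cong₂ _+_ (𝟙-no (connected? G S) (size0⇒disconnected G size))
                     (𝟙-no (connected? Ḡ S) (size0⇒disconnected Ḡ size)))
          (sym (small z<s size))
  by-size 1 size =
    trans (cong₂ _+_ (𝟙-yes (connected? G S) (size1⇒connected G S size))
                     (𝟙-yes (connected? Ḡ S) (size1⇒connected Ḡ S size)))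
          (cong (2 +_) (sym (small (s≤s z<s) size)))
  by-size (suc (suc m)) size =
    𝟙-both (connected? G S) (connected? Ḡ S) (biConnected? G S)
      (λ (conn , co-conn) → subst (2 ≤_) (sym size) (s≤s (s≤s z≤n)) , conn , co-conn) proj₂
      (connected-or-co-connected G S (size-pos⇒nonempty S (subst (0 <_) (sym size) z<s)))

∑𝟙≡0⇔ : ∀ {n} {P : Subset n → Set} (P? : Decidable P) → (∑ n (𝟙 ∘ P?) ≡ 0) ⇔ (∀ S → ¬ P S)
∑𝟙≡0⇔ {n} P? = mk⇔
  (λ total≡0 S p → contradiction
     (trans (sym (𝟙-yes (P? S) p)) (sum-map-zero⁻ (subsets n) (𝟙 ∘ P?) total≡0 (∈-subsets S))) λ ())
  (λ none → sum-map-zero (subsets n) λ S → 𝟙-no (P? S) (none S))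

η-decomposition : ∀ {n} (G : Graph n) {a b} → IsEta G a → IsEta (complement G) b →
                  a + b ≡ 2 ^ n + n ∸ 1 + ∑ n (𝟙 ∘ biConnected? G)
η-decomposition {n} G {a} {b} ηG ηḠ = begin
  a + b
    ≡⟨ cong₂ _+_ (IsCount⇒∑ (connected? G) ηG) (IsCount⇒∑ (connected? (complement G)) ηḠ) ⟩
  ∑ n (𝟙 ∘ connected? G) + ∑ n (𝟙 ∘ connected? (complement G))
    ≡⟨ ∑-+ n _ _ ⟨
  ∑ n (λ S → 𝟙 (connected? G S) + 𝟙 (connected? (complement G) S))
    ≡⟨ ∑-cong n (connections G) ⟩
  ∑ n (λ S → baseline ∣ S ∣ + 𝟙 (biConnected? G S))
    ≡⟨ ∑-+ n _ _ ⟩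
  ∑ n (λ S → baseline ∣ S ∣) + ∑ n (𝟙 ∘ biConnected? G)
    ≡⟨ cong (_+ ∑ n (𝟙 ∘ biConnected? G)) (∑-baseline n) ⟩
  2 ^ n + n ∸ 1 + ∑ n (𝟙 ∘ biConnected? G) ∎
  where open ≡-Reasoning

-- No vertex set is biconnected iff G or its complement has no induced path of length ≥ 3:
-- a biconnected set contains an induced P4 (Seinsche), an induced P4 spans a biconnected
-- set, and P4s of G and of its complement correspond to each other.
biconnected-free⇔P4-free : ∀ {n} (G : Graph n) →
  (∀ S → ¬ BiConnected G S) ⇔ (¬ HasInducedPathOfLength≥3 G ⊎ ¬ HasInducedPathOfLength≥3 (complement G))
biconnected-free⇔P4-free G = mk⇔
  (λ none → inj₁ λ path → let S , bi = P4⇒biconnected (path⇒P4 path) in none S bi)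
  (λ free S bi → let p4 = seinsche G S bi in
     [ (λ ¬path → ¬path (P4⇒path p4))
     , (λ ¬co-path → ¬co-path (P4⇒path (HasP4-flip (complement-complementary G) p4))) ]′ free)

+-≡-left⇔ : ∀ L t → (L + t ≡ L) ⇔ (t ≡ 0)
+-≡-left⇔ L t = mk⇔ (λ e → +-cancelˡ-≡ L t 0 (trans e (sym (+-identityʳ L))))
                    (λ { refl → +-identityʳ L })

ηₖ-lower-bound : ∀ {n} (G : Graph n) {k a b} → 1 < k → IsEtaK G k a → IsEtaK (complement G) k b →
                 n C k ≤ a + b
ηₖ-lower-bound {n} G {k} {a} {b} 1<k ηₖG ηₖḠ = begin
  n C k
    ≡⟨ ∑-size n k ⟨
  ∑ n (𝟙 ∘ HasSize? k)
    ≤⟨ ∑-mono n (size-k-covered G 1<k) ⟩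
  ∑ n (λ S → 𝟙 (connectedOfSize? G k S) + 𝟙 (connectedOfSize? Ḡ k S))
    ≡⟨ ∑-+ n _ _ ⟩
  ∑ n (𝟙 ∘ connectedOfSize? G k) + ∑ n (𝟙 ∘ connectedOfSize? Ḡ k)
    ≡⟨ cong₂ _+_ (IsCount⇒∑ _ ηₖG) (IsCount⇒∑ _ ηₖḠ) ⟨
  a + b ∎
  where open ≤-Reasoning
        Ḡ = complement G

η-lower-bound : ∀ {n} (G : Graph n) {a b} → IsEta G a → IsEta (complement G) b → 2 ^ n + n ∸ 1 ≤ a + b
η-lower-bound {n} G ηG ηḠ = subst (2 ^ n + n ∸ 1 ≤_) (sym (η-decomposition G ηG ηḠ)) (m≤m+n _ _)

η-equality : ∀ {n} (G : Graph n) {a b} → IsEta G a → IsEta (complement G) b →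
             (a + b ≡ 2 ^ n + n ∸ 1) ⇔
             (¬ HasInducedPathOfLength≥3 G ⊎ ¬ HasInducedPathOfLength≥3 (complement G))
η-equality G ηG ηḠ rewrite η-decomposition G ηG ηḠ =
  ⇔.trans (+-≡-left⇔ _ _) (⇔.trans (∑𝟙≡0⇔ (biConnected? G)) (biconnected-free⇔P4-free G))

theorem2 : ∀ (n : ℕ) (G : Graph n) →
    ((k : ℕ) → Σ ℕ (IsEtaK G k) × Σ ℕ (IsEtaK (complement G) k))
    × Σ ℕ (IsEta G) × Σ ℕ (IsEta (complement G))
    × (∀ (k a b : ℕ) → 1 < k → IsEtaK G k a → IsEtaK (complement G) k b →
         n C k ≤ a + b)
    × (∀ (a b : ℕ) → IsEta G a → IsEta (complement G) b →
         (2 ^ n + n ∸ 1 ≤ a + b)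
         × ((a + b ≡ 2 ^ n + n ∸ 1) ⇔
              (¬ HasInducedPathOfLength≥3 G ⊎ ¬ HasInducedPathOfLength≥3 (complement G))))
theorem2 n G =
  (λ k → count (connectedOfSize? G k) , count (connectedOfSize? (complement G) k)) ,
  count (connected? G) , count (connected? (complement G)) ,
  (λ k a b → ηₖ-lower-bound G) ,
  (λ a b ηG ηḠ → η-lower-bound G ηG ηḠ , η-equality G ηG ηḠ)
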